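{- Let $\mathcal{A}$ be a computable $(2,0):1$ structure, let $C$ be a cohesive set, and let $\mathcal{B}=\prod_C\mathcal{A}$. Then $\mathcal{A}$ and $\mathcal{B}$ have the same cycle character, the same path character, and the same endpath character.
   Context: A $(2,0):1$ structure $(A,f)$ is a set $A$ with a total function $f:A\to A$ such that every $a\in A$ has either $0$ or $2$ preimages under $f$; it is computable if $A\subseteq\omega$ and $f$ are computable. The orbit of $a$ is the connected component of $a$ in the directed graph with edges $(x,f(x))$. An orbit is a $k$-cycle if it contains $x$ with $f^k(x)=x$ and $f^t(x)\neq x$ for $0<t<k$. The length $l(a)$ of $a$ is the number of distinct elements of $\{f^n(a):n\in\omega\}$ (finite or infinite). For $k,n\ge1$: the cycle character is $\chi_{cycle}(\mathcal{A})=\{\langle k,n\rangle:\mathcal{A}$ has at least $n$ $k$-cycles$\}$; the path character is $\chi_{path}(\mathcal{A})=\{\langle k,n\rangle:\mathcal{A}$ has at least $n$ elements $a$ with $l(a)=k\}$; the endpath character is $\chi_{endpath}(\mathcal{A})=\{\langle k,n\rangle:\mathcal{A}$ has at least $n$ elements $a\notin f(A)$ with $l(a)=k\}$. A set $C\subseteq\omega$ is cohesive if it is infinite and for every c.e. set $W$, one of $W\cap C$, $\overline{W}\cap C$ is finite; $X\subseteq^*Y$ means $X\setminus Y$ is finite. The cohesive power $\prod_C\mathcal{A}$ has as domain the partial computable functions $\psi:\omega\to A$ with $C\subseteq^*\mathrm{dom}(\psi)$, modulo $\psi_1=_C\psi_2$ iff $C\subseteq^*\{i:\psi_1(i)\downarrow=\psi_2(i)\downarrow\}$,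 with $f([\psi])=[f\circ\psi]$. -}

module Defs where

open import Level using (0ℓ)
open import Data.Nat using (ℕ; zero; suc; _<_; _≤_)
open import Data.Fin using (Fin)
open import Data.Vec using (Vec; []; _∷_; lookup)
open import Data.Product using (Σ; ∃; _×_; _,_; proj₁)
open import Data.Sum using (_⊎_)
open import Relation.Nullary using (¬_)
open import Relation.Binary.PropositionalEquality using (_≡_; _≢_)
open import Relation.Binary.Construct.Closure.ReflexiveTransitive using (Star)
open import Relation.Binary.Construct.Closure.Symmetric using (SymClosure)

data PR : ℕ → Set where
  cZ : ∀ {n} → PR n
  cS : PR 1
  cP : ∀ {n} → Fin n → PR n
  cC : ∀ {m n} → PR m → Vec (PR n) m → PR n
  cR : ∀ {n} → PR n → PR (suc (suc n)) → PR (suc n)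
  cM : ∀ {n} → PR (suc n) → PR n

data _[_]⇓_ : ∀ {n} → PR n → Vec ℕ n → ℕ → Set
data _[_]⇓*_ : ∀ {m n} → Vec (PR n) m → Vec ℕ n → Vec ℕ m → Set
data Search : ∀ {n} → PR (suc n) → Vec ℕ n → ℕ → ℕ → Set

data _[_]⇓_ where
  zeroE : ∀ {n} {xs : Vec ℕ n} → cZ [ xs ]⇓ 0
  succE : ∀ {x} → cS [ x ∷ [] ]⇓ suc x
  projE : ∀ {n} {xs : Vec ℕ n} (i : Fin n) → cP i [ xs ]⇓ lookup xs i
  compE : ∀ {m n} {f : PR m} {gs : Vec (PR n) m} {xs ys v} →
          gs [ xs ]⇓* ys → f [ ys ]⇓ v → cC f gs [ xs ]⇓ v
  recZ  : ∀ {n} {f : PR n} {g} {xs v} →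
          f [ xs ]⇓ v → cR f g [ 0 ∷ xs ]⇓ v
  recS  : ∀ {n} {f : PR n} {g} {xs y u v} →
          cR f g [ y ∷ xs ]⇓ u → g [ y ∷ u ∷ xs ]⇓ v →
          cR f g [ suc y ∷ xs ]⇓ v
  muE   : ∀ {n} {f : PR (suc n)} {xs v} →
          Search f xs 0 v → cM f [ xs ]⇓ v

data _[_]⇓*_ where
  []E : ∀ {n} {xs : Vec ℕ n} → [] [ xs ]⇓* []
  ∷E  : ∀ {m n} {g : PR n} {gs : Vec (PR n) m} {xs y ys} →
        g [ xs ]⇓ y → gs [ xs ]⇓* ys → (g ∷ gs) [ xs ]⇓* (y ∷ ys)

-- Search f xs y v : searching upward from y, the least z ≥ y with
-- f(z,xs) = 0 is v, and f(z',xs) is defined and nonzero for y ≤ z' < v.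
data Search where
  found : ∀ {n} {f : PR (suc n)} {xs y} →
          f [ y ∷ xs ]⇓ 0 → Search f xs y y
  next  : ∀ {n} {f : PR (suc n)} {xs y w v} →
          f [ y ∷ xs ]⇓ suc w → Search f xs (suc y) v → Search f xs y v

_⟨_⟩⇓_ : PR 1 → ℕ → ℕ → Set
e ⟨ x ⟩⇓ v = e [ x ∷ [] ]⇓ v

-- domain of a unary partial computable function (= a c.e. set)
Dom : PR 1 → ℕ → Set
Dom e x = ∃ λ v → e ⟨ x ⟩⇓ v

FiniteSet : (ℕ → Set) → Set
FiniteSet P = ∃ λ N → ∀ x → P x → x < N

InfiniteSet : (ℕ → Set) → Set
InfiniteSet P = ∀ N → ∃ λ x → N ≤ x × P x

_⊆*_ : (ℕ → Set) → (ℕ → Set) → Set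
X ⊆* Y = ∃ λ N → ∀ i → X i → N ≤ i → Y i

Cohesive : (ℕ → Set) → Set
Cohesive C = InfiniteSet C ×
  ((W : PR 1) → FiniteSet (λ x → Dom W x × C x)
              ⊎ FiniteSet (λ x → ¬ Dom W x × C x))

-- Computable (2,0):1 structures.  A = {x | χ(x) = 0} with χ total
-- computable; f is a partial computable function, total on A, with values
-- in A.

record Computable20 : Set where
  field
    χ       : PR 1
    χ-total : ∀ x → ∃ λ v → χ ⟨ x ⟩⇓ v
    f       : PR 1
  InA : ℕ → Set
  InA x = χ ⟨ x ⟩⇓ 0
  field
    f-total : ∀ x → InA x → ∃ λ y → InA y × f ⟨ x ⟩⇓ y
    two-zero : ∀ a → InA a →
      (∀ x → InA x → ¬ f ⟨ x ⟩⇓ a)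
      ⊎ (Σ ℕ λ x → Σ ℕ λ y → InA x × InA y × x ≢ y ×
           f ⟨ x ⟩⇓ a × f ⟨ y ⟩⇓ a ×
           (∀ z → InA z → f ⟨ z ⟩⇓ a → z ≡ x ⊎ z ≡ y))

-- Abstract unary structures: a carrier with an equality (a setoid
-- equality, needed for the cohesive power) and the graph of f.

record Str : Set₁ where
  field
    Carrier : Set
    _≈_     : Carrier → Carrier → Set
    F       : Carrier → Carrier → Set

module _ (S : Str) where
  open Str S

  It : ℕ → Carrier → Carrier → Set
  It zero    x y = x ≈ y
  It (suc m) x y = Σ Carrier λ z → F x z × It m z y

  Edge : Carrier → Carrier → Set
  Edge x y = F x y ⊎ x ≈ y

  SameOrbit : Carrier → Carrier → Set
  SameOrbit = Star (SymClosure Edge)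

  HasPeriod : ℕ → Carrier → Set
  HasPeriod k x = It k x x × (∀ t → 0 < t → t < k → ¬ It t x x)

  -- l(a) = k  (k finite): {f^m a : m ∈ ω} has exactly k distinct elements,
  -- namely f^0 a, …, f^(k-1) a.
  Length : Carrier → ℕ → Set
  Length a k =
    (∀ i j y z → i < j → j < k → It i a y → It j a z → ¬ (y ≈ z)) ×
    (∀ m y → It m a y → ∃ λ j → j < k × (Σ Carrier λ z → It j a z × z ≈ y))

  InImage : Carrier → Set
  InImage a = Σ Carrier λ y → F y a

  AtLeast : ℕ → (Carrier → Set) → Set
  AtLeast n P = Σ (Fin n → Carrier) λ xs →
    (∀ i j → i ≢ j → ¬ (xs i ≈ xs j)) × (∀ i → P (xs i))

  -- ⟨k,n⟩ ∈ χ_cycle : at least n (distinct) orbits that are k-cycles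
  CycleChar : ℕ → ℕ → Set
  CycleChar k n = Σ (Fin n → Carrier) λ xs →
    (∀ i j → i ≢ j → ¬ SameOrbit (xs i) (xs j)) × (∀ i → HasPeriod k (xs i))

  PathChar : ℕ → ℕ → Set
  PathChar k n = AtLeast n (λ a → Length a k)

  EndpathChar : ℕ → ℕ → Set
  EndpathChar k n = AtLeast n (λ a → ¬ InImage a × Length a k)

module _ (𝒜 : Computable20) where
  open Computable20 𝒜

  StrA : Str
  StrA = record
    { Carrier = Σ ℕ InA
    ; _≈_     = λ x y → proj₁ x ≡ proj₁ y
    ; F       = λ x y → f ⟨ proj₁ x ⟩⇓ proj₁ y
    }

  PowElem : (ℕ → Set) → Set
  PowElem C = Σ (PR 1) λ ψ → (∀ i v → ψ ⟨ i ⟩⇓ v → InA v) × (C ⊆* Dom ψ)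

  StrB : (ℕ → Set) → Str
  StrB C = record
    { Carrier = PowElem C
    ; _≈_     = λ p q → C ⊆* (λ i → ∃ λ v → proj₁ p ⟨ i ⟩⇓ v × proj₁ q ⟨ i ⟩⇓ v)
    -- f([ψ]) = [φ]  iff  f ∘ ψ =_C φ
    ; F       = λ p q → C ⊆* (λ i → Σ ℕ λ v → Σ ℕ λ w →
                   proj₁ p ⟨ i ⟩⇓ v × f ⟨ v ⟩⇓ w × proj₁ q ⟨ i ⟩⇓ w)
    }

module Submission where

-- For fixed t and codes ψ, φ the set of i with f^t(ψ i) = φ i is c.e., and so is
-- the set of i at which ψ i has an f-preimage in A. A cohesive set lies almost
-- entirely inside or almost entirely outside each such set, so in ∏_C 𝒜 an equation
-- f^t[ψ] = [φ], its negation, and "[ψ] has no preimage" each hold iff they hold at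
-- almost every coordinate i ∈ C. Every character is a finite combination of such
-- facts: l(a) = k is witnessed by the distinctness of a, …, f^(k-1) a together with
-- one return f^k a = f^j a (j < k), and two k-cycles share an orbit iff one is f^j of
-- the other for some j < k. So a witness in the power is evaluated at one coordinate
-- of C where its finitely many facts all hold, while a witness in 𝒜 is carried to
-- the power by constant functions, which reflect equality.

open import Defs
open import Level using (0ℓ)
open import Axiom.ExcludedMiddle using (ExcludedMiddle)
open import Data.Nat using (ℕ; zero; suc; _+_; _*_; _∸_; _<_; _≤_; z≤n; s≤s; s≤s⁻¹; pred; _⊔_; NonZero)
open import Data.Nat.Properties
open import Data.Nat.DivMod using (_%_; _/_; m≡m%n+[m/n]*n; m%n<n)
open import Data.Nat.Induction using (<-rec)
open import Data.Fin using (Fin) renaming (zero to fz; suc to fs)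
open import Data.Fin.Properties using () renaming (_≟_ to _≟ᶠ_)
open import Data.Vec using (Vec; []; _∷_)
open import Data.Product using (Σ; ∃; _×_; _,_; proj₁; proj₂)
open import Data.Sum using (_⊎_; inj₁; inj₂)
open import Data.Empty using (⊥-elim)
open import Function.Bundles using (_⇔_; mk⇔)
open import Relation.Nullary using (¬_; Dec; yes; no)
open import Relation.Binary.Structures using (IsEquivalence)
open import Relation.Binary.PropositionalEquality
  using (_≡_; _≢_; refl; sym; trans; subst; subst₂; cong; cong₂)
open import Relation.Binary.Construct.Closure.ReflexiveTransitive using (ε; _◅_; _◅◅_; reverse)
open import Relation.Binary.Construct.Closure.Symmetric using (SymClosure; fwd; bwd; symmetric)

⇓-deterministic : ∀ {n} {e : PR n} {xs v w} → e [ xs ]⇓ v → e [ xs ]⇓ w → v ≡ w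
⇓*-deterministic : ∀ {m n} {es : Vec (PR n) m} {xs vs ws} →
                   es [ xs ]⇓* vs → es [ xs ]⇓* ws → vs ≡ ws
Search-deterministic : ∀ {n} {e : PR (suc n)} {xs y v w} →
                       Search e xs y v → Search e xs y w → v ≡ w

⇓-deterministic zeroE zeroE = refl
⇓-deterministic succE succE = refl
⇓-deterministic (projE i) (projE .i) = refl
⇓-deterministic (compE ds d) (compE ds′ d′) with ⇓*-deterministic ds ds′
... | refl = ⇓-deterministic d d′
⇓-deterministic (recZ d) (recZ d′) = ⇓-deterministic d d′
⇓-deterministic (recS d e) (recS d′ e′) with ⇓-deterministic d d′
... | refl = ⇓-deterministic e e′
⇓-deterministic (muE s) (muE s′) = Search-deterministic s s′

⇓*-deterministic []E []E = refl
⇓*-deterministic (∷E d ds) (∷E d′ ds′) = cong₂ _∷_ (⇓-deterministic d d′) (⇓*-deterministic ds ds′)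

Search-deterministic (found d) (found d′) = refl
Search-deterministic (found d) (next d′ s′) with ⇓-deterministic d d′
... | ()
Search-deterministic (next d s) (found d′) with ⇓-deterministic d d′
... | ()
Search-deterministic (next d s) (next d′ s′) = Search-deterministic s s′

Search⇒⇓0 : ∀ {n} {e : PR (suc n)} {xs y v} → Search e xs y v → e [ v ∷ xs ]⇓ 0
Search⇒⇓0 (found d) = d
Search⇒⇓0 (next d s) = Search⇒⇓0 s

infixr 9 _∘ᶜ_

_∘ᶜ_ : ∀ {n} → PR 1 → PR n → PR n
g ∘ᶜ h = cC g (h ∷ [])

∘ᶜ⇓ : ∀ {n} {g : PR 1} {h : PR n} {xs u v} → h [ xs ]⇓ u → g ⟨ u ⟩⇓ v → (g ∘ᶜ h) [ xs ]⇓ v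
∘ᶜ⇓ dh dg = compE (∷E dh []E) dg

const : ∀ {n} → ℕ → PR n
const zero = cZ
const (suc a) = cS ∘ᶜ const a

const⇓ : ∀ {n} a {xs : Vec ℕ n} → const a [ xs ]⇓ a
const⇓ zero = zeroE
const⇓ (suc a) = ∘ᶜ⇓ (const⇓ a) succE

predCode : PR 1
predCode = cR cZ (cP fz)

predCode⇓ : ∀ y → predCode ⟨ y ⟩⇓ pred y
predCode⇓ zero = recZ zeroE
predCode⇓ (suc y) = recS (predCode⇓ y) (projE fz)

-- the arguments are in the order of recursion: [ y , x ] ↦ x ∸ y
monusCode : PR 2
monusCode = cR (cP fz) (predCode ∘ᶜ cP (fs fz))

monusCode⇓ : ∀ y x → monusCode [ y ∷ x ∷ [] ]⇓ (x ∸ y)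
monusCode⇓ zero x = recZ (projE fz)
monusCode⇓ (suc y) x = subst (monusCode [ suc y ∷ x ∷ [] ]⇓_) (pred[m∸n]≡m∸[1+n] x y)
  (recS (monusCode⇓ y x) (∘ᶜ⇓ (projE (fs fz)) (predCode⇓ (x ∸ y))))

1∸n≢0⇒n≡0 : ∀ {n} → 1 ∸ n ≢ 0 → n ≡ 0
1∸n≢0⇒n≡0 {zero} _ = refl
1∸n≢0⇒n≡0 {suc n} 1∸n≢0 = ⊥-elim (1∸n≢0 (0∸n≡0 n))

plusCode : PR 2
plusCode = cR (cP fz) (cS ∘ᶜ cP (fs fz))

plusCode⇓ : ∀ y x → plusCode [ y ∷ x ∷ [] ]⇓ (y + x)
plusCode⇓ zero x = recZ (projE fz)
plusCode⇓ (suc y) x = recS (plusCode⇓ y x) (∘ᶜ⇓ (projE (fs fz)) succE)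

distCode : PR 2
distCode = cC plusCode (cC monusCode (cP (fs fz) ∷ cP fz ∷ []) ∷ monusCode ∷ [])

distCode⇓ : ∀ a b → distCode [ a ∷ b ∷ [] ]⇓ ((a ∸ b) + (b ∸ a))
distCode⇓ a b = compE
  (∷E (compE (∷E (projE (fs fz)) (∷E (projE fz) []E)) (monusCode⇓ b a)) (∷E (monusCode⇓ a b) []E))
  (plusCode⇓ (a ∸ b) (b ∸ a))

distCode⇓0⇒≡ : ∀ {a b} → distCode [ a ∷ b ∷ [] ]⇓ 0 → a ≡ b
distCode⇓0⇒≡ {a} {b} d = ≤-antisym (m∸n≡0⇒m≤n (m+n≡0⇒m≡0 (a ∸ b) dist≡0))
                                    (m∸n≡0⇒m≤n (m+n≡0⇒n≡0 (a ∸ b) dist≡0))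
  where
    dist≡0 : (a ∸ b) + (b ∸ a) ≡ 0
    dist≡0 = ⇓-deterministic (distCode⇓ a b) d

distCode⇓0 : ∀ a → distCode [ a ∷ a ∷ [] ]⇓ 0
distCode⇓0 a = subst (distCode [ a ∷ a ∷ [] ]⇓_) (cong (λ d → d + d) (n∸n≡0 a)) (distCode⇓ a a)

cM-defined : ∀ {n} {e : PR (suc n)} {xs x₀} → (∀ z → ∃ λ r → e [ z ∷ xs ]⇓ r) →
             e [ x₀ ∷ xs ]⇓ 0 → ∃ λ v → cM e [ xs ]⇓ v
cM-defined {e = e} {xs} {x₀} total hit = let (v , s) = search x₀ 0 (+-identityʳ x₀) in v , muE s
  where
    search : ∀ d y → d + y ≡ x₀ → ∃ (Search e xs y)
    search zero y refl = y , found hit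
    search (suc d) y d+y≡x₀ with total y
    ... | zero , ey⇓0 = y , found ey⇓0
    ... | suc r , ey⇓r = let (v , s) = search d (suc y) (trans (+-suc d y) d+y≡x₀) in v , next ey⇓r s

record IsFunctional (S : Str) : Set where
  open Str S
  field
    isEquivalence : IsEquivalence _≈_
    F-resp        : ∀ {x x′ y y′} → x ≈ x′ → y ≈ y′ → F x y → F x′ y′
    F-functional  : ∀ {x y y′} → F x y → F x y′ → y ≈ y′

  open IsEquivalence isEquivalence public
    renaming (refl to ≈-refl; sym to ≈-sym; trans to ≈-trans)

Total : Str → Set
Total S = ∀ x → Σ (Str.Carrier S) (Str.F S x)

module _ (S : Str) where
  open Str S

  CommonIterate : Carrier → Carrier → Set
  CommonIterate x y = Σ ℕ λ h → Σ ℕ λ g → Σ Carrier λ z → It S h x z × It S g y z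

  Distinct : Carrier → ℕ → Set
  Distinct a k = ∀ i j y z → i < j → j < k → It S i a y → It S j a z → ¬ (y ≈ z)

  Returns : Carrier → ℕ → Set
  Returns a k = Σ ℕ λ j → j < k × Σ Carrier λ z → It S k a z × It S j a z

module Iteration {S : Str} (S-functional : IsFunctional S) where
  open Str S
  open IsFunctional S-functional

  It-resp : ∀ m {x x′ y y′} → x ≈ x′ → y ≈ y′ → It S m x y → It S m x′ y′
  It-resp zero x≈x′ y≈y′ x≈y = ≈-trans (≈-sym x≈x′) (≈-trans x≈y y≈y′)
  It-resp (suc m) x≈x′ y≈y′ (z , Fxz , r) = z , F-resp x≈x′ ≈-refl Fxz , It-resp m ≈-refl y≈y′ r

  It-functional : ∀ m {x y y′} → It S m x y → It S m x y′ → y ≈ y′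
  It-functional zero x≈y x≈y′ = ≈-trans (≈-sym x≈y) x≈y′
  It-functional (suc m) (z , Fxz , r) (z′ , Fxz′ , r′) =
    It-functional m r (It-resp m (≈-sym (F-functional Fxz Fxz′)) ≈-refl r′)

  It-total : Total S → ∀ m x → Σ Carrier (It S m x)
  It-total total zero x = x , ≈-refl
  It-total total (suc m) x =
    let (z , Fxz) = total x ; (y , r) = It-total total m z in y , z , Fxz , r

  It-+ : ∀ a {b x y z} → It S a x y → It S b y z → It S (a + b) x z
  It-+ zero {b} x≈y q = It-resp b (≈-sym x≈y) ≈-refl q
  It-+ (suc a) (w , Fxw , r) q = w , Fxw , It-+ a r q

  It-split : ∀ a {b x z} → It S (a + b) x z → Σ Carrier λ y → It S a x y × It S b y z
  It-split zero {x = x} r = x , ≈-refl , r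
  It-split (suc a) (w , Fxw , r) =
    let (y , p , q) = It-split a r in y , (w , Fxw , p) , q

  It-*-periodic : ∀ {k y} → It S k y y → ∀ g → It S (g * k) y y
  It-*-periodic p zero = ≈-refl
  It-*-periodic {k} p (suc g) = It-+ k p (It-*-periodic p g)

  It-%-periodic : ∀ {p x y} .⦃ _ : NonZero p ⦄ → It S p x x → ∀ m → It S m x y → It S (m % p) x y
  It-%-periodic {p} {x} {y} periodic m r =
    let (w , q , r′) = It-split ((m / p) * p) (subst (λ t → It S t x y) m≡[m/p]*p+m%p r)
    in It-resp (m % p) (It-functional ((m / p) * p) q (It-*-periodic periodic (m / p))) ≈-refl r′
    where
      m≡[m/p]*p+m%p : m ≡ (m / p) * p + m % p
      m≡[m/p]*p+m%p = trans (m≡m%n+[m/n]*n m p) (+-comm (m % p) _)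

  It⇒SameOrbit : ∀ m {x z} → It S m x z → SameOrbit S x z
  It⇒SameOrbit zero x≈z = fwd (inj₂ x≈z) ◅ ε
  It⇒SameOrbit (suc m) (w , Fxw , r) = fwd (inj₁ Fxw) ◅ It⇒SameOrbit m r

  CommonIterate⇒SameOrbit : ∀ {x y} → CommonIterate S x y → SameOrbit S x y
  CommonIterate⇒SameOrbit (h , g , z , p , q) =
    It⇒SameOrbit h p ◅◅ reverse (symmetric (Edge S)) (It⇒SameOrbit g q)

  CommonIterate-extend : ∀ {x x′ y} → SymClosure (Edge S) x x′ → CommonIterate S x′ y → CommonIterate S x y
  CommonIterate-extend (fwd (inj₁ Fxx′)) (h , g , z , p , q) = suc h , g , z , (_ , Fxx′ , p) , q
  CommonIterate-extend (fwd (inj₂ x≈x′)) (h , g , z , p , q) = h , g , z , It-resp h (≈-sym x≈x′) ≈-refl p , q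
  CommonIterate-extend (bwd (inj₂ x′≈x)) (h , g , z , p , q) = h , g , z , It-resp h x′≈x ≈-refl p , q
  CommonIterate-extend (bwd (inj₁ Fx′x)) (suc h , g , z , (w , Fx′w , p) , q) =
    h , g , z , It-resp h (F-functional Fx′w Fx′x) ≈-refl p , q
  -- x = f x′ with x′ ≈ f^g y, so x is the common iterate f^(g+1) y
  CommonIterate-extend {x} (bwd (inj₁ Fx′x)) (zero , g , z , x′≈z , q) =
    0 , g + 1 , x , ≈-refl , It-+ g q (x , F-resp x′≈z ≈-refl Fx′x , ≈-refl)

  SameOrbit⇒CommonIterate : ∀ {x y} → SameOrbit S x y → CommonIterate S x y
  SameOrbit⇒CommonIterate {x} ε = 0 , 0 , x , ≈-refl , ≈-refl
  SameOrbit⇒CommonIterate (e ◅ rest) = CommonIterate-extend e (SameOrbit⇒CommonIterate rest)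

  periodic-SameOrbit⇒It< : ∀ {k x y} → It S (suc k) x x → It S (suc k) y y → SameOrbit S x y →
                             Σ ℕ λ j → j < suc k × It S j x y
  periodic-SameOrbit⇒It< {k} {x} {y} x-periodic y-periodic orbit = reduce (SameOrbit⇒CommonIterate orbit)
    where
      -- f^(g(k+1)) y = y, and its first g steps lead from y to the common iterate z
      reduce : CommonIterate S x y → Σ ℕ λ j → j < suc k × It S j x y
      reduce (h , g , z , x↦z , y↦z) =
        let (w , y↦w , w↦y) = It-split g (subst (λ t → It S t y y) (*-suc g k) (It-*-periodic y-periodic g))
            z↦y = It-resp (g * k) (It-functional g y↦w y↦z) ≈-refl w↦y
            m = h + g * k
        in m % suc k , m%n<n m (suc k) , It-%-periodic x-periodic m (It-+ h x↦z z↦y)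

  Length⇒Returns : Total S → ∀ {a k} → Length S a k → Returns S a k
  Length⇒Returns total {a} {k} (_ , covered) =
    let (y , a↦y) = It-total total k a
        (j , j<k , z , a↦z , z≈y) = covered k y a↦y
    in j , j<k , y , a↦y , It-resp j ≈-refl z≈y a↦z

  Distinct×Returns⇒Length : ∀ {a k} → Distinct S a k → Returns S a k → Length S a k
  Distinct×Returns⇒Length {a} {k} distinct (j , j<k , z , a↦ᵏz , a↦ʲz) =
    distinct , λ m y → <-rec Covered fold m {y}
    where
      Covered : ℕ → Set
      Covered m = ∀ {y} → It S m a y → ∃ λ j′ → j′ < k × (Σ Carrier λ z′ → It S j′ a z′ × z′ ≈ y)
      -- f^(k + r) a = f^(j + r) a, with j + r < k + r
      fold : ∀ m → (∀ {m′} → m′ < m → Covered m′) → Covered m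
      fold m smaller {y} a↦y with m <? k
      ... | yes m<k = m , m<k , y , a↦y , ≈-refl
      ... | no m≮k = smaller j+r<m a↦ʲ⁺ʳy
        where
          k≤m : k ≤ m
          k≤m = ≮⇒≥ m≮k
          r : ℕ
          r = m ∸ k
          j+r<m : j + r < m
          j+r<m = subst (j + r <_) (m+[n∸m]≡n k≤m) (+-monoˡ-< r j<k)
          a↦ʲ⁺ʳy : It S (j + r) a y
          a↦ʲ⁺ʳy = let (u , a↦u , u↦y) = It-split k (subst (λ t → It S t a y) (sym (m+[n∸m]≡n k≤m)) a↦y)
                   in It-+ j a↦ʲz (It-resp r (It-functional k a↦u a↦ᵏz) ≈-refl u↦y)

module Embedding {S T : Str} (S-functional : IsFunctional S) (S-total : Total S) (T-functional : IsFunctional T)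
                 (e : Str.Carrier S → Str.Carrier T)
                 (e-resp     : ∀ {x y} → Str._≈_ S x y → Str._≈_ T (e x) (e y))
                 (e-F        : ∀ {x y} → Str.F S x y → Str.F T (e x) (e y))
                 (e-reflects : ∀ {x y} → Str._≈_ T (e x) (e y) → Str._≈_ S x y) where
  private
    module S = Str S
    module T = Str T
    module FS = IsFunctional S-functional
    module FT = IsFunctional T-functional
    module IS = Iteration S-functional
    module IT = Iteration T-functional

  It-e : ∀ m {x y} → It S m x y → It T m (e x) (e y)
  It-e zero x≈y = e-resp x≈y
  It-e (suc m) (z , Fxz , r) = e z , e-F Fxz , It-e m r

  It-from-e : ∀ m {x q} → It T m (e x) q → Σ S.Carrier λ u → It S m x u × q T.≈ e u
  It-from-e m {x} r =
    let (u , x↦u) = IS.It-total S-total m x in u , x↦u , IT.It-functional m r (It-e m x↦u)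

  It-e⁻¹ : ∀ m {x y} → It T m (e x) (e y) → It S m x y
  It-e⁻¹ m r =
    let (u , x↦u , ey≈eu) = It-from-e m r in IS.It-resp m FS.≈-refl (e-reflects (FT.≈-sym ey≈eu)) x↦u

  HasPeriod-e : ∀ {k x} → HasPeriod S k x → HasPeriod T k (e x)
  HasPeriod-e {k} (x↦x , minimal) = It-e k x↦x , λ t 0<t t<k r → minimal t 0<t t<k (It-e⁻¹ t r)

  SameOrbit-e⁻¹ : ∀ {x y} → SameOrbit T (e x) (e y) → SameOrbit S x y
  SameOrbit-e⁻¹ orbit with IT.SameOrbit⇒CommonIterate orbit
  ... | h , g , z , p , q =
    let (u , x↦u , z≈eu) = It-from-e h p
        (u′ , y↦u′ , z≈eu′) = It-from-e g q
        u′≈u = e-reflects (FT.≈-trans (FT.≈-sym z≈eu′) z≈eu)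
    in IS.CommonIterate⇒SameOrbit (h , g , u , x↦u , IS.It-resp g FS.≈-refl u′≈u y↦u′)

  Distinct-e : ∀ {x k} → Distinct S x k → Distinct T (e x) k
  Distinct-e distinct i j y z i<j j<k p q y≈z =
    let (u , x↦u , y≈eu) = It-from-e i p
        (u′ , x↦u′ , z≈eu′) = It-from-e j q
    in distinct i j u u′ i<j j<k x↦u x↦u′ (e-reflects (FT.≈-trans (FT.≈-sym y≈eu) (FT.≈-trans y≈z z≈eu′)))

  Length-e : ∀ {x k} → Length S x k → Length T (e x) k
  Length-e {k = k} L with IS.Length⇒Returns S-total L
  ... | j , j<k , z , p , q =
    IT.Distinct×Returns⇒Length (Distinct-e (proj₁ L)) (j , j<k , e z , It-e k p , It-e j q)

  CycleChar-e : ∀ {k n} → CycleChar S k n → CycleChar T k n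
  CycleChar-e (xs , disjoint , periodic) =
    (λ a → e (xs a)) , (λ a b a≢b orbit → disjoint a b a≢b (SameOrbit-e⁻¹ orbit)) ,
    λ a → HasPeriod-e (periodic a)

  AtLeast-e : ∀ {n P Q} → (∀ {x} → P x → Q (e x)) → AtLeast S n P → AtLeast T n Q
  AtLeast-e P⇒Q (xs , distinct , P-xs) =
    (λ a → e (xs a)) , (λ a b a≢b exa≈exb → distinct a b a≢b (e-reflects exa≈exb)) , λ a → P⇒Q (P-xs a)

module AlmostAll (C : ℕ → Set) where

  ⊆*-universal : ∀ {P : ℕ → Set} → (∀ i → P i) → C ⊆* P
  ⊆*-universal P-all = 0 , λ i _ _ → P-all i

  ⊆*-map : ∀ {P Q : ℕ → Set} → (∀ i → P i → Q i) → C ⊆* P → C ⊆* Q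
  ⊆*-map P⇒Q (N , P-ae) = N , λ i i∈C N≤i → P⇒Q i (P-ae i i∈C N≤i)

  ⊆*-zipWith : ∀ {P Q R : ℕ → Set} → (∀ i → P i → Q i → R i) → C ⊆* P → C ⊆* Q → C ⊆* R
  ⊆*-zipWith PQ⇒R (N , P-ae) (M , Q-ae) = N ⊔ M , λ i i∈C N⊔M≤i →
    PQ⇒R i (P-ae i i∈C (≤-trans (m≤m⊔n N M) N⊔M≤i)) (Q-ae i i∈C (≤-trans (m≤n⊔m N M) N⊔M≤i))

  ⊆*-× : ∀ {P Q : ℕ → Set} → C ⊆* P → C ⊆* Q → C ⊆* (λ i → P i × Q i)
  ⊆*-× = ⊆*-zipWith (λ _ → _,_)

  ⊆*-∀Fin : ∀ n {P : Fin n → ℕ → Set} → (∀ a → C ⊆* P a) → C ⊆* (λ i → ∀ a → P a i)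
  ⊆*-∀Fin zero P-ae = ⊆*-universal (λ _ ())
  ⊆*-∀Fin (suc n) {P} P-ae = ⊆*-zipWith cons (P-ae fz) (⊆*-∀Fin n (λ a → P-ae (fs a)))
    where
      cons : ∀ i → P fz i → (∀ a → P (fs a) i) → ∀ a → P a i
      cons i p ps fz = p
      cons i p ps (fs a) = ps a

  ⊆*-∀< : ∀ k {P : ℕ → ℕ → Set} → (∀ j → j < k → C ⊆* P j) → C ⊆* (λ i → ∀ j → j < k → P j i)
  ⊆*-∀< zero P-ae = ⊆*-universal (λ _ _ ())
  ⊆*-∀< (suc k) {P} P-ae = ⊆*-zipWith snoc (⊆*-∀< k (λ j j<k → P-ae j (m<n⇒m<1+n j<k))) (P-ae k (n<1+n k))
    where
      snoc : ∀ i → (∀ j → j < k → P j i) → P k i → ∀ j → j < suc k → P j i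
      snoc i ps p j j<1+k with j ≟ k
      ... | yes refl = p
      ... | no j≢k = ps j (≤∧≢⇒< (s≤s⁻¹ j<1+k) j≢k)

  ⊆*-∀≢ : ∀ n {R : Fin n → Fin n → ℕ → Set} → (∀ a b → a ≢ b → C ⊆* R a b) →
          C ⊆* (λ i → ∀ a b → a ≢ b → R a b i)
  ⊆*-∀≢ n {R} R-ae = ⊆*-∀Fin n (λ a → ⊆*-∀Fin n (λ b → R-ae′ a b))
    where
      R-ae′ : ∀ a b → C ⊆* (λ i → a ≢ b → R a b i)
      R-ae′ a b with a ≟ᶠ b
      ... | yes a≡b = ⊆*-universal (λ _ a≢b → ⊥-elim (a≢b a≡b))
      ... | no a≢b = ⊆*-map (λ _ r _ → r) (R-ae a b a≢b)

  ⊆*-witness : InfiniteSet C → ∀ {P : ℕ → Set} → C ⊆* P → Σ ℕ P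
  ⊆*-witness infinite (N , P-ae) = let (i , N≤i , i∈C) = infinite N in i , P-ae i i∈C N≤i

  -- Excluded middle turns "C ∖ W is finite" into "almost every i ∈ C lies in W".
  cohesive-dichotomy : ExcludedMiddle 0ℓ → Cohesive C → (W : PR 1) →
                       C ⊆* Dom W ⊎ C ⊆* (λ i → ¬ Dom W i)
  cohesive-dichotomy em (_ , split) W with split W
  ... | inj₁ (N , bounded) = inj₂ (N , λ i i∈C N≤i i∈W → <⇒≱ (bounded i (i∈W , i∈C)) N≤i)
  ... | inj₂ (N , bounded) = inj₁ (N , λ i i∈C N≤i → decided i i∈C N≤i em)
    where
      decided : ∀ i → C i → N ≤ i → Dec (Dom W i) → Dom W i
      decided i i∈C N≤i (yes i∈W) = i∈W
      decided i i∈C N≤i (no i∉W) = ⊥-elim (<⇒≱ (bounded i (i∉W , i∈C)) N≤i)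

module Structure (𝒜 : Computable20) where
  open Computable20 𝒜

  A : Str
  A = StrA 𝒜

  -- the graph of f on all of ℕ, through which values of codes are compared
  Graph : Str
  Graph = record { Carrier = ℕ ; _≈_ = _≡_ ; F = f ⟨_⟩⇓_ }

  A-functional : IsFunctional A
  A-functional = record
    { isEquivalence = record { refl = refl ; sym = sym ; trans = trans }
    ; F-resp = λ { refl refl Fxy → Fxy }
    ; F-functional = ⇓-deterministic
    }

  A-total : Total A
  A-total (x , x∈A) = let (y , y∈A , fx⇓y) = f-total x x∈A in (y , y∈A) , fx⇓y

  f-closed : ∀ {x y} → InA x → f ⟨ x ⟩⇓ y → InA y
  f-closed {x} x∈A fx⇓y with f-total x x∈A
  ... | y′ , y′∈A , fx⇓y′ = subst InA (⇓-deterministic fx⇓y′ fx⇓y) y′∈A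

  It-A⇒Graph : ∀ m {x y} → It A m x y → It Graph m (proj₁ x) (proj₁ y)
  It-A⇒Graph zero x≡y = x≡y
  It-A⇒Graph (suc m) (z , Fxz , r) = proj₁ z , Fxz , It-A⇒Graph m r

  It-Graph⇒A : ∀ m (x y : Str.Carrier A) → It Graph m (proj₁ x) (proj₁ y) → It A m x y
  It-Graph⇒A zero x y x≡y = x≡y
  It-Graph⇒A (suc m) x y (z , fx⇓z , r) = (z , f-closed (proj₂ x) fx⇓z) , fx⇓z , It-Graph⇒A m _ y r

  iterCode : ℕ → PR 1
  iterCode zero = cP fz
  iterCode (suc t) = iterCode t ∘ᶜ f

  iterCode⇓⇒It : ∀ t {v w} → iterCode t ⟨ v ⟩⇓ w → It Graph t v w
  iterCode⇓⇒It zero (projE fz) = refl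
  iterCode⇓⇒It (suc t) (compE (∷E fv⇓u []E) r) = _ , fv⇓u , iterCode⇓⇒It t r

  It⇒iterCode⇓ : ∀ t {v w} → It Graph t v w → iterCode t ⟨ v ⟩⇓ w
  It⇒iterCode⇓ zero refl = projE fz
  It⇒iterCode⇓ (suc t) (u , fv⇓u , r) = ∘ᶜ⇓ fv⇓u (It⇒iterCode⇓ t r)

  IterateAt : ℕ → PR 1 → PR 1 → ℕ → Set
  IterateAt t ψ φ i = Σ ℕ λ v → Σ ℕ λ w → ψ ⟨ i ⟩⇓ v × φ ⟨ i ⟩⇓ w × It Graph t v w

  -- Minimisation over a dummy variable makes the test a partial function
  -- whose domain is the c.e. set of i with f^t(ψ i) = φ i.
  iterateTest : ℕ → PR 1 → PR 1 → PR 1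
  iterateTest t ψ φ = cM (cC distCode (iterCode t ∘ᶜ ψ ∘ᶜ cP (fs fz) ∷ φ ∘ᶜ cP (fs fz) ∷ []))

  IterateAt⇒Dom : ∀ t ψ φ {i} → IterateAt t ψ φ i → Dom (iterateTest t ψ φ) i
  IterateAt⇒Dom t ψ φ (v , w , ψi⇓v , φi⇓w , v↦w) =
    0 , muE (found (compE (∷E (∘ᶜ⇓ (∘ᶜ⇓ (projE (fs fz)) ψi⇓v) (It⇒iterCode⇓ t v↦w))
                           (∷E (∘ᶜ⇓ (projE (fs fz)) φi⇓w) []E))
                    (distCode⇓0 w)))

  Dom⇒IterateAt : ∀ t ψ φ {i} → Dom (iterateTest t ψ φ) i → IterateAt t ψ φ i
  Dom⇒IterateAt t ψ φ (_ , muE s) with Search⇒⇓0 s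
  ... | compE (∷E (compE (∷E (compE (∷E (projE _) []E) ψi⇓v) []E) v↦u)
               (∷E (compE (∷E (projE _) []E) φi⇓w) []E)) u=w =
    _ , _ , ψi⇓v , φi⇓w , subst (It Graph t _) (distCode⇓0⇒≡ u=w) (iterCode⇓⇒It t v↦u)

  -- arguments [ flag , u , x , v ]
  hitTest : PR 4
  hitTest = cC distCode (f ∘ᶜ cP (fs (fs fz)) ∷ cP (fs (fs (fs fz))) ∷ [])

  guardedTest : PR 3
  guardedTest = cR (const 1) hitTest

  inAFlag : PR 2
  inAFlag = cC monusCode (χ ∘ᶜ cP fz ∷ const 1 ∷ [])

  -- The recursion on the flag 1 ∸ χ x is a conditional: f is evaluated only
  -- at x ∈ A, where it is total, so the search cannot diverge before it
  -- reaches a preimage of ψ i.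
  preimageTest : PR 1 → PR 2
  preimageTest ψ = cC guardedTest (inAFlag ∷ cP fz ∷ ψ ∘ᶜ cP (fs fz) ∷ [])

  preimageSearch : PR 1 → PR 1
  preimageSearch ψ = cM (preimageTest ψ)

  preimageTest⇓ : ∀ ψ {x i c v r} → χ ⟨ x ⟩⇓ c → ψ ⟨ i ⟩⇓ v →
                  guardedTest [ 1 ∸ c ∷ x ∷ v ∷ [] ]⇓ r → preimageTest ψ [ x ∷ i ∷ [] ]⇓ r
  preimageTest⇓ ψ {c = c} χx⇓c ψi⇓v test⇓r =
    compE (∷E (compE (∷E (∘ᶜ⇓ (projE fz) χx⇓c) (∷E (const⇓ 1) []E)) (monusCode⇓ c 1))
              (∷E (projE fz) (∷E (∘ᶜ⇓ (projE (fs fz)) ψi⇓v) []E)))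
          test⇓r

  guardedTest-inA : ∀ {x y v r} → f ⟨ x ⟩⇓ y → distCode [ y ∷ v ∷ [] ]⇓ r →
                    guardedTest [ 1 ∷ x ∷ v ∷ [] ]⇓ r
  guardedTest-inA fx⇓y dist⇓r =
    recS (recZ (const⇓ 1))
         (compE (∷E (∘ᶜ⇓ (projE (fs (fs fz))) fx⇓y) (∷E (projE (fs (fs (fs fz)))) []E)) dist⇓r)

  preimageTest-total : ∀ ψ {i v} → ψ ⟨ i ⟩⇓ v → ∀ x → ∃ λ r → preimageTest ψ [ x ∷ i ∷ [] ]⇓ r
  preimageTest-total ψ {v = v} ψi⇓v x with χ-total x
  ... | zero , x∈A =
    let (y , _ , fx⇓y) = f-total x x∈A in _ , preimageTest⇓ ψ x∈A ψi⇓v (guardedTest-inA fx⇓y (distCode⇓ y v))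
  ... | suc c , χx⇓c =
    _ , preimageTest⇓ ψ χx⇓c ψi⇓v
          (subst (λ flag → guardedTest [ flag ∷ x ∷ v ∷ [] ]⇓ 1) (sym (0∸n≡0 c)) (recZ (const⇓ 1)))

  guardedTest⇓0 : ∀ {flag x v} → guardedTest [ flag ∷ x ∷ v ∷ [] ]⇓ 0 → flag ≢ 0 × f ⟨ x ⟩⇓ v
  guardedTest⇓0 (recZ one⇓0) with ⇓-deterministic one⇓0 (const⇓ 1)
  ... | ()
  guardedTest⇓0 (recS _ (compE (∷E (compE (∷E (projE _) []E) fx⇓u) (∷E (projE _) []E)) u=v)) =
    (λ ()) , subst (f ⟨ _ ⟩⇓_) (distCode⇓0⇒≡ u=v) fx⇓u

  preimageTest⇓0 : ∀ ψ {x i} → preimageTest ψ [ x ∷ i ∷ [] ]⇓ 0 →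
                   Σ ℕ λ v → ψ ⟨ i ⟩⇓ v × InA x × f ⟨ x ⟩⇓ v
  preimageTest⇓0 ψ (compE (∷E (compE (∷E (compE (∷E (projE fz) []E) χx⇓c) (∷E one⇓ []E)) flag⇓)
                              (∷E (projE fz) (∷E (compE (∷E (projE (fs fz)) []E) ψi⇓v) []E))) test⇓0)
    with ⇓-deterministic one⇓ (const⇓ 1)
  ... | refl =
    let (flag≢0 , fx⇓v) = guardedTest⇓0 test⇓0
        1∸c≡flag = ⇓-deterministic (monusCode⇓ _ 1) flag⇓
    in _ , ψi⇓v , subst (χ ⟨ _ ⟩⇓_) (1∸n≢0⇒n≡0 (λ 1∸c≡0 → flag≢0 (trans (sym 1∸c≡flag) 1∸c≡0))) χx⇓c , fx⇓v

  preimageSearch-sound : ∀ ψ {i x} → preimageSearch ψ ⟨ i ⟩⇓ x →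
                         Σ ℕ λ v → ψ ⟨ i ⟩⇓ v × InA x × f ⟨ x ⟩⇓ v
  preimageSearch-sound ψ (muE s) = preimageTest⇓0 ψ (Search⇒⇓0 s)

  preimageSearch-complete : ∀ ψ {i v x} → ψ ⟨ i ⟩⇓ v → InA x → f ⟨ x ⟩⇓ v → Dom (preimageSearch ψ) i
  preimageSearch-complete ψ {v = v} ψi⇓v x∈A fx⇓v =
    cM-defined (preimageTest-total ψ ψi⇓v) (preimageTest⇓ ψ x∈A ψi⇓v (guardedTest-inA fx⇓v (distCode⇓0 v)))

module Power (𝒜 : Computable20) (C : ℕ → Set) where
  open Computable20 𝒜
  open Structure 𝒜
  open AlmostAll C

  B : Str
  B = StrB 𝒜 C

  code : PowElem 𝒜 C → PR 1
  code = proj₁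

  code-in-A : ∀ p {i v} → code p ⟨ i ⟩⇓ v → InA v
  code-in-A p {i} {v} = proj₁ (proj₂ p) i v

  code-defined : ∀ p → C ⊆* Dom (code p)
  code-defined p = proj₂ (proj₂ p)

  valueAt : ∀ p {i v} → code p ⟨ i ⟩⇓ v → Str.Carrier A
  valueAt p {v = v} pi⇓v = v , code-in-A p pi⇓v

  apply-f : PowElem 𝒜 C → PowElem 𝒜 C
  apply-f p = f ∘ᶜ code p ,
              (λ { i w (compE (∷E pi⇓v []E) fv⇓w) → f-closed (code-in-A p pi⇓v) fv⇓w }) ,
              ⊆*-map (λ i (v , pi⇓v) → let (w , _ , fv⇓w) = f-total v (code-in-A p pi⇓v) in w , ∘ᶜ⇓ pi⇓v fv⇓w)
                     (code-defined p)

  B-functional : IsFunctional B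
  B-functional = record
    { isEquivalence = record
      { refl  = λ {p} → ⊆*-map (λ i (v , pi⇓v) → v , pi⇓v , pi⇓v) (code-defined p)
      ; sym   = ⊆*-map (λ i (v , pi⇓v , qi⇓v) → v , qi⇓v , pi⇓v)
      ; trans = ⊆*-zipWith λ i (v , pi⇓v , qi⇓v) (w , qi⇓w , ri⇓w) →
                  v , pi⇓v , subst (_ ⟨ i ⟩⇓_) (⇓-deterministic qi⇓w qi⇓v) ri⇓w
      }
    ; F-resp = λ p≈p′ q≈q′ Fpq → ⊆*-zipWith
        (λ i ((v′ , pi⇓v′ , p′i⇓v′) , (w′ , qi⇓w′ , q′i⇓w′)) (v , w , pi⇓v , fv⇓w , qi⇓w) →
           v , w , subst (_ ⟨ i ⟩⇓_) (⇓-deterministic pi⇓v′ pi⇓v) p′i⇓v′ , fv⇓w ,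
           subst (_ ⟨ i ⟩⇓_) (⇓-deterministic qi⇓w′ qi⇓w) q′i⇓w′)
        (⊆*-× p≈p′ q≈q′) Fpq
    ; F-functional = ⊆*-zipWith λ i (v , w , pi⇓v , fv⇓w , qi⇓w) (v′ , w′ , pi⇓v′ , fv′⇓w′ , q′i⇓w′) →
        w , qi⇓w , subst (_ ⟨ i ⟩⇓_)
                         (⇓-deterministic (subst (f ⟨_⟩⇓ w′) (⇓-deterministic pi⇓v′ pi⇓v) fv′⇓w′) fv⇓w) q′i⇓w′
    }

  B-total : Total B
  B-total p = apply-f p , ⊆*-map (λ i (v , pi⇓v) → let (w , _ , fv⇓w) = f-total v (code-in-A p pi⇓v)
                                                   in v , w , pi⇓v , fv⇓w , ∘ᶜ⇓ pi⇓v fv⇓w)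
                                 (code-defined p)

  It-B⇒ae : ∀ m {p q} → It B m p q → C ⊆* IterateAt m (code p) (code q)
  It-B⇒ae zero p≈q = ⊆*-map (λ i (v , pi⇓v , qi⇓v) → v , v , pi⇓v , qi⇓v , refl) p≈q
  It-B⇒ae (suc m) (r , Fpr , r↦q) = ⊆*-zipWith
    (λ i (v , w , pi⇓v , fv⇓w , ri⇓w) (w′ , u , ri⇓w′ , qi⇓u , w′↦u) →
       v , u , pi⇓v , qi⇓u , w , fv⇓w , subst (λ t → It Graph m t u) (⇓-deterministic ri⇓w′ ri⇓w) w′↦u)
    Fpr (It-B⇒ae m r↦q)

  ae⇒It-B : ∀ m {p q} → C ⊆* IterateAt m (code p) (code q) → It B m p q
  ae⇒It-B zero at = ⊆*-map (λ { i (v , _ , pi⇓v , qi⇓v , refl) → v , pi⇓v , qi⇓v }) at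
  ae⇒It-B (suc m) {p} at =
    apply-f p ,
    ⊆*-map (λ i (v , _ , pi⇓v , _ , u , fv⇓u , _) → v , u , pi⇓v , fv⇓u , ∘ᶜ⇓ pi⇓v fv⇓u) at ,
    ae⇒It-B m (⊆*-map (λ i (v , w , pi⇓v , qi⇓w , u , fv⇓u , u↦w) → u , w , ∘ᶜ⇓ pi⇓v fv⇓u , qi⇓w , u↦w) at)

  HoldsAt : (Str.Carrier A → Set) → PowElem 𝒜 C → ℕ → Set
  HoldsAt P p i = ∀ {v} (pi⇓v : code p ⟨ i ⟩⇓ v) → P (valueAt p pi⇓v)

  HoldsAt₂ : (Str.Carrier A → Str.Carrier A → Set) → PowElem 𝒜 C → PowElem 𝒜 C → ℕ → Set
  HoldsAt₂ R p q i =
    ∀ {v w} (pi⇓v : code p ⟨ i ⟩⇓ v) (qi⇓w : code q ⟨ i ⟩⇓ w) → R (valueAt p pi⇓v) (valueAt q qi⇓w)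

  It-B⇒HoldsAt₂ : ∀ m {p q} → It B m p q → C ⊆* HoldsAt₂ (It A m) p q
  It-B⇒HoldsAt₂ m {p} {q} p↦q = ⊆*-map
    (λ i (v′ , w′ , pi⇓v′ , qi⇓w′ , v′↦w′) {_} {_} pi⇓v qi⇓w →
       It-Graph⇒A m (valueAt p pi⇓v) (valueAt q qi⇓w)
         (subst₂ (It Graph m) (⇓-deterministic pi⇓v′ pi⇓v) (⇓-deterministic qi⇓w′ qi⇓w) v′↦w′))
    (It-B⇒ae m p↦q)

  Returns-B⇒ae : ∀ {y k} → Returns B y k → C ⊆* HoldsAt (λ x → Returns A x k) y
  Returns-B⇒ae {k = k} (j , j<k , z , y↦ᵏz , y↦ʲz) = ⊆*-zipWith
    (λ i (w , zi⇓w) (y↦ᵏz-at , y↦ʲz-at) {_} yi⇓v →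
       j , j<k , valueAt z zi⇓w , y↦ᵏz-at yi⇓v zi⇓w , y↦ʲz-at yi⇓v zi⇓w)
    (code-defined z) (⊆*-× (It-B⇒HoldsAt₂ k y↦ᵏz) (It-B⇒HoldsAt₂ j y↦ʲz))

  constant : Str.Carrier A → PowElem 𝒜 C
  constant (a , a∈A) = const a , (λ i v a⇓v → subst InA (⇓-deterministic (const⇓ a) a⇓v) a∈A) ,
                       ⊆*-universal (λ i → a , const⇓ a)

  constant-resp : ∀ {x y} → Str._≈_ A x y → Str._≈_ B (constant x) (constant y)
  constant-resp {y = y} refl = ⊆*-universal (λ i → proj₁ y , const⇓ _ , const⇓ _)

  constant-F : ∀ {x y} → Str.F A x y → Str.F B (constant x) (constant y)
  constant-F fx⇓y = ⊆*-universal (λ i → _ , _ , const⇓ _ , fx⇓y , const⇓ _)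

  evaluate-at : ∀ {n} (P : Str.Carrier A → Set) (R : Str.Carrier A → Str.Carrier A → Set)
                (ys : Fin n → PowElem 𝒜 C) i →
                (∀ a → Dom (code (ys a)) i × HoldsAt P (ys a) i) → (∀ a b → a ≢ b → HoldsAt₂ R (ys a) (ys b) i) →
                Σ (Fin n → Str.Carrier A) λ xs → (∀ a b → a ≢ b → R (xs a) (xs b)) × (∀ a → P (xs a))
  evaluate-at P R ys i defined related =
    xs , (λ a b a≢b → related a b a≢b (yi⇓ a) (yi⇓ b)) , λ a → proj₂ (defined a) (yi⇓ a)
    where
      yi⇓ : ∀ a → code (ys a) ⟨ i ⟩⇓ proj₁ (proj₁ (defined a))
      yi⇓ a = proj₂ (proj₁ (defined a))
      xs : Fin _ → Str.Carrier A
      xs a = valueAt (ys a) (yi⇓ a)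

  module _ (infinite : InfiniteSet C) where

    constant-reflects : ∀ {x y} → Str._≈_ B (constant x) (constant y) → Str._≈_ A x y
    constant-reflects {x} {y} cx≈cy =
      let (i , v , x⇓v , y⇓v) = ⊆*-witness infinite cx≈cy
      in trans (⇓-deterministic (const⇓ (proj₁ x)) x⇓v) (sym (⇓-deterministic (const⇓ (proj₁ y)) y⇓v))

    constant-¬InImage : ∀ {x} → ¬ InImage A x → ¬ InImage B (constant x)
    constant-¬InImage {x} x∉f[A] (r , Frx) with ⊆*-witness infinite Frx
    ... | i , v , w , ri⇓v , fv⇓w , x⇓w with ⇓-deterministic (const⇓ (proj₁ x)) x⇓w
    ... | refl = x∉f[A] (valueAt r ri⇓v , fv⇓w)

    evaluate-tuple : ∀ {n} (P : Str.Carrier A → Set) (R : Str.Carrier A → Str.Carrier A → Set)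
                     (ys : Fin n → PowElem 𝒜 C) →
                     (∀ a → C ⊆* HoldsAt P (ys a)) → (∀ a b → a ≢ b → C ⊆* HoldsAt₂ R (ys a) (ys b)) →
                     Σ (Fin n → Str.Carrier A) λ xs → (∀ a b → a ≢ b → R (xs a) (xs b)) × (∀ a → P (xs a))
    evaluate-tuple {n} P R ys P-ae R-ae =
      let (i , defined , related) = ⊆*-witness infinite
            (⊆*-× (⊆*-∀Fin n (λ a → ⊆*-× (code-defined (ys a)) (P-ae a))) (⊆*-∀≢ n R-ae))
      in evaluate-at P R ys i defined related

module CohesivePower (em : ExcludedMiddle 0ℓ) (𝒜 : Computable20) (C : ℕ → Set) (cohesive : Cohesive C) where
  open Computable20 𝒜
  open Structure 𝒜
  open AlmostAll C
  open Power 𝒜 C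
  private
    module IA = Iteration A-functional
    module IB = Iteration B-functional

  ¬It-B⇒ae : ∀ m {p q} → ¬ It B m p q → C ⊆* HoldsAt₂ (λ x y → ¬ It A m x y) p q
  ¬It-B⇒ae m {p} {q} p↛q with cohesive-dichotomy em cohesive (iterateTest m (code p) (code q))
  ... | inj₁ test-ae = ⊥-elim (p↛q (ae⇒It-B m (⊆*-map (λ i → Dom⇒IterateAt m (code p) (code q)) test-ae)))
  ... | inj₂ ¬test-ae = ⊆*-map
    (λ i i∉test {_} {_} pi⇓v qi⇓w x↦y →
       i∉test (IterateAt⇒Dom m (code p) (code q) (_ , _ , pi⇓v , qi⇓w , It-A⇒Graph m x↦y)))
    ¬test-ae

  ¬InImage-B⇒ae : ∀ {p} → ¬ InImage B p → C ⊆* HoldsAt (λ x → ¬ InImage A x) p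
  ¬InImage-B⇒ae {p} p∉f[B] with cohesive-dichotomy em cohesive (preimageSearch (code p))
  ... | inj₂ ¬search-ae = ⊆*-map
    (λ i i∉search {_} pi⇓v ((x , x∈A) , fx⇓v) → i∉search (preimageSearch-complete (code p) pi⇓v x∈A fx⇓v))
    ¬search-ae
  ... | inj₁ search-ae =
    ⊥-elim (p∉f[B] (preimage , ⊆*-map (λ i (x , search⇓x) → F-preimage search⇓x) search-ae))
    where
      preimage : PowElem 𝒜 C
      preimage = preimageSearch (code p) ,
                 (λ i x search⇓x → proj₁ (proj₂ (proj₂ (preimageSearch-sound (code p) search⇓x)))) ,
                 search-ae
      F-preimage : ∀ {i x} → preimageSearch (code p) ⟨ i ⟩⇓ x →
                   Σ ℕ λ v → Σ ℕ λ w → preimageSearch (code p) ⟨ i ⟩⇓ v × f ⟨ v ⟩⇓ w × code p ⟨ i ⟩⇓ w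
      F-preimage search⇓x = let (w , pi⇓w , _ , fx⇓w) = preimageSearch-sound (code p) search⇓x
                            in _ , w , search⇓x , fx⇓w , pi⇓w

  HasPeriod-B⇒ae : ∀ {k y} → HasPeriod B k y → C ⊆* HoldsAt (HasPeriod A k) y
  HasPeriod-B⇒ae {k} {y} (y↦y , minimal) = ⊆*-zipWith
    (λ i y↦y-at minimal-at {_} yi⇓v → y↦y-at yi⇓v yi⇓v , λ t 0<t t<k → minimal-at t t<k 0<t yi⇓v yi⇓v)
    (It-B⇒HoldsAt₂ k y↦y) (⊆*-∀< k minimal-ae)
    where
      minimal-ae : ∀ t → t < k → C ⊆* (λ i → 0 < t → HoldsAt₂ (λ x x′ → ¬ It A t x x′) y y i)
      minimal-ae zero _ = ⊆*-universal (λ i ())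
      minimal-ae (suc t) t<k =
        ⊆*-map (λ i ¬y↦y _ → ¬y↦y) (¬It-B⇒ae (suc t) {y} {y} (minimal (suc t) (s≤s z≤n) t<k))

  Distinct-B⇒ae : ∀ {y k} → Distinct B y k → C ⊆* HoldsAt (λ x → Distinct A x k) y
  Distinct-B⇒ae {y} {k} distinct =
    ⊆*-map (λ i separated {_} yi⇓v i′ j a b i′<j j<k → separated j j<k i′ i′<j yi⇓v a b)
           (⊆*-∀< k (λ j j<k → ⊆*-∀< j (λ i′ i′<j → separated-ae i′ j i′<j j<k)))
    where
      Separated : ℕ → ℕ → ℕ → Set
      Separated i′ j = HoldsAt (λ x → ∀ a b → It A i′ x a → It A j x b → ¬ Str._≈_ A a b) y
      separated-ae : ∀ i′ j → i′ < j → j < k → C ⊆* Separated i′ j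
      separated-ae i′ j i′<j j<k =
        let (u , y↦u) = IB.It-total B-total i′ y
            (u′ , y↦u′) = IB.It-total B-total j y
        in ⊆*-zipWith
          (λ i ((w , ui⇓w) , (w′ , u′i⇓w′)) (y↦u-at , y↦u′-at , u≉u′-at) {_} yi⇓v a b x↦a x↦b a≈b →
             u≉u′-at ui⇓w u′i⇓w′
               (trans (IA.It-functional i′ (y↦u-at yi⇓v ui⇓w) x↦a)
                      (trans a≈b (IA.It-functional j x↦b (y↦u′-at yi⇓v u′i⇓w′)))))
          (⊆*-× (code-defined u) (code-defined u′))
          (⊆*-× (It-B⇒HoldsAt₂ i′ y↦u)
                (⊆*-× (It-B⇒HoldsAt₂ j y↦u′) (¬It-B⇒ae 0 {u} {u′} (distinct i′ j u u′ i′<j j<k y↦u y↦u′))))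

  Length-B⇒ae : ∀ {y k} → Length B y k → C ⊆* HoldsAt (λ x → Length A x k) y
  Length-B⇒ae L = ⊆*-zipWith
    (λ i distinct returns {_} yi⇓v → IA.Distinct×Returns⇒Length (distinct yi⇓v) (returns yi⇓v))
    (Distinct-B⇒ae (proj₁ L)) (Returns-B⇒ae (IB.Length⇒Returns B-total L))

  open Embedding A-functional A-total B-functional constant
                 (λ {x} {y} → constant-resp {x} {y}) (λ {x} {y} → constant-F {x} {y})
                 (λ {x} {y} → constant-reflects (proj₁ cohesive) {x} {y})

  CycleChar-A⇒B : ∀ {k n} → CycleChar A k n → CycleChar B k n
  CycleChar-A⇒B = CycleChar-e

  PathChar-A⇒B : ∀ {k n} → PathChar A k n → PathChar B k n
  PathChar-A⇒B {k} = AtLeast-e {P = λ x → Length A x k} {Q = λ y → Length B y k} Length-e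

  EndpathChar-A⇒B : ∀ {k n} → EndpathChar A k n → EndpathChar B k n
  EndpathChar-A⇒B {k} =
    AtLeast-e {P = λ x → ¬ InImage A x × Length A x k} {Q = λ y → ¬ InImage B y × Length B y k}
      (λ {x} (¬image , length) → constant-¬InImage (proj₁ cohesive) {x} ¬image , Length-e length)

  CycleChar-B⇒A : ∀ {k n} → CycleChar B (suc k) n → CycleChar A (suc k) n
  CycleChar-B⇒A {k} (ys , disjoint , periodic) =
    let (xs , apart , periodic′) = evaluate-tuple (proj₁ cohesive) (HasPeriod A (suc k)) Apart ys
                                     (λ a → HasPeriod-B⇒ae {suc k} {ys a} (periodic a)) apart-ae
    in xs , apart⇒disjoint xs apart periodic′ , periodic′
    where
      Apart : Str.Carrier A → Str.Carrier A → Set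
      Apart x y = ∀ j → j < suc k → ¬ It A j x y

      apart-ae : ∀ a b → a ≢ b → C ⊆* HoldsAt₂ Apart (ys a) (ys b)
      apart-ae a b a≢b = ⊆*-map (λ i apart {_} {_} yai⇓v ybi⇓w j j<k → apart j j<k yai⇓v ybi⇓w)
        (⊆*-∀< (suc k) λ j _ → ¬It-B⇒ae j {ys a} {ys b}
                                  (λ ya↦yb → disjoint a b a≢b (IB.It⇒SameOrbit j ya↦yb)))

      apart⇒disjoint : ∀ {n} (xs : Fin n → Str.Carrier A) → (∀ a b → a ≢ b → Apart (xs a) (xs b)) →
                       (∀ a → HasPeriod A (suc k) (xs a)) → ∀ a b → a ≢ b → ¬ SameOrbit A (xs a) (xs b)
      apart⇒disjoint xs apart periodic a b a≢b orbit =
        let (j , j<k , xa↦xb) = IA.periodic-SameOrbit⇒It< (proj₁ (periodic a)) (proj₁ (periodic b)) orbit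
        in apart a b a≢b j j<k xa↦xb

  PathChar-B⇒A : ∀ {k n} → PathChar B k n → PathChar A k n
  PathChar-B⇒A {k} (ys , distinct , lengths) =
    evaluate-tuple (proj₁ cohesive) (λ x → Length A x k) (λ x y → ¬ Str._≈_ A x y) ys
      (λ a → Length-B⇒ae (lengths a)) (λ a b a≢b → ¬It-B⇒ae 0 {ys a} {ys b} (distinct a b a≢b))

  EndpathChar-B⇒A : ∀ {k n} → EndpathChar B k n → EndpathChar A k n
  EndpathChar-B⇒A {k} (ys , distinct , endpaths) =
    evaluate-tuple (proj₁ cohesive) (λ x → ¬ InImage A x × Length A x k) (λ x y → ¬ Str._≈_ A x y) ys
      (λ a → ⊆*-zipWith (λ i ¬image length {_} yi⇓v → ¬image yi⇓v , length yi⇓v)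
                        (¬InImage-B⇒ae {ys a} (proj₁ (endpaths a))) (Length-B⇒ae (proj₂ (endpaths a))))
      (λ a b a≢b → ¬It-B⇒ae 0 {ys a} {ys b} (distinct a b a≢b))

mainTheorem13 : ExcludedMiddle 0ℓ → (𝒜 : Computable20) → (C : ℕ → Set) → Cohesive C →
    ∀ k n → 1 ≤ k → 1 ≤ n →
      (CycleChar (StrA 𝒜) k n ⇔ CycleChar (StrB 𝒜 C) k n) ×
      (PathChar (StrA 𝒜) k n ⇔ PathChar (StrB 𝒜 C) k n) ×
      (EndpathChar (StrA 𝒜) k n ⇔ EndpathChar (StrB 𝒜 C) k n)
mainTheorem13 em 𝒜 C cohesive (suc k) n (s≤s z≤n) _ =
  mk⇔ CycleChar-A⇒B CycleChar-B⇒A , mk⇔ PathChar-A⇒B PathChar-B⇒A , mk⇔ EndpathChar-A⇒B EndpathChar-B⇒A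
  where open CohesivePower em 𝒜 C cohesive
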